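{- Let $\mathcal{U}$ and $\mathcal{V}$ be nonprincipal ultrafilters on $\omega$, let $f:\mathcal{U}\to\mathcal{V}$ be a monotone cofinal map, and suppose there is a cofinal subset $\mathcal{C}\subseteq\mathcal{U}$ such that $f\restriction\mathcal{C}$ is represented by a basic map. Then there is a monotone map $\tilde f:2^{\omega}\to 2^{\omega}$ such that: (1) $\tilde f$ is represented by a basic map (on all of $2^\omega$); (2) $\tilde f\restriction\mathcal{C}=f\restriction\mathcal{C}$; and (3) $\tilde f\restriction\mathcal{U}$ is a cofinal map from $\mathcal{U}$ to $\mathcal{V}$.
   Context: Subsets of $\omega$ are identified with their characteristic functions in $2^\omega$; for $X\subseteq\omega$ and $m<\omega$, $X\restriction m$ denotes the characteristic function of $X\cap m$ with domain $m$ (also identified with the set $X\cap m$). $2^{<\omega}$ is the set of finite $0$-$1$ sequences; $s\sqsubseteq t$ means $s$ is an initial segment of $t$. A map $f:\mathcal{U}\to\mathcal{V}$ between ultrafilters is monotone if $X\supseteq Y$ implies $f(X)\supseteq f(Y)$, and cofinal if the image of every cofinal subset (filter base) of $(\mathcal{U},\supseteq)$ is cofinal in $(\mathcal{V},\supseteq)$. Given a strictly increasing sequence $(k_m)_{m<\omega}$ and $C\subseteq\bigcup_{m}2^{k_m}$, a map $\hat f:C\to 2^{<\omega}$ is basic if: it is level preserving ($\hat f$ maps $C\cap 2^{k_m}$ into $2^m$ for every $m$); end-extension preserving (for $m<m'$, $s\in C\cap 2^{k_m}$, $s'\in C\cap 2^{k_{m'}}$, $s\sqsubseteq s'$ implies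 $\hat f(s)\sqsubseteq\hat f(s')$); and monotone (if $\{i:s(i)=1\}\subseteq\{i:t(i)=1\}$ then $\{i:\hat f(s)(i)=1\}\subseteq\{i:\hat f(t)(i)=1\}$). A map $f$ on $\mathcal{C}\subseteq 2^\omega$ is represented by a basic map $\hat f$ if there is a strictly increasing $(k_m)_{m<\omega}$ such that the domain of $\hat f$ is $C=\{X\restriction k_m: X\in\mathcal{C}, m<\omega\}$ and $f(X)=\bigcup_{m<\omega}\hat f(X\restriction k_m)$ for every $X\in\mathcal{C}$. -}

module Defs where

open import Level using (0ℓ)
open import Data.Bool using (Bool; true; false; not; _∧_)
open import Data.Nat using (ℕ; zero; suc; _<_; _≤_)
open import Data.Fin using (toℕ)
open import Data.Vec using (Vec; []; _∷_; tabulate)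
open import Data.Product using (Σ; ∃; ∃-syntax; _×_; _,_)
open import Data.Unit using (⊤; tt)
open import Relation.Nullary using (¬_)
open import Relation.Binary.PropositionalEquality using (_≡_; refl)
open import Function.Bundles using (_⇔_)
import Data.Sum
import Data.Nat
import Relation.Nullary

-- Subsets of ω, identified with characteristic functions in 2^ω.
Subset : Set
Subset = ℕ → Bool

Family : Set₁
Family = Subset → Set

_⊆_ : Subset → Subset → Set
X ⊆ Y = ∀ i → X i ≡ true → Y i ≡ true

_∩_ : Subset → Subset → Subset
(X ∩ Y) i = X i ∧ Y i

compl : Subset → Subset
compl X i = not (X i)

full empty : Subset
full _ = true
empty _ = false

singleton : ℕ → Subset
singleton n i with n Data.Nat.≟ i
... | Relation.Nullary.yes _ = true
... | Relation.Nullary.no _ = false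

record IsUltrafilter (U : Family) : Set where
  field
    upward  : ∀ {X Y} → U X → X ⊆ Y → U Y
    inter   : ∀ {X Y} → U X → U Y → U (X ∩ Y)
    hasFull : U full
    noEmpty : ¬ U empty
    ultra   : ∀ X → U X Data.Sum.⊎ U (compl X)

IsNonprincipalUltrafilter : Family → Set
IsNonprincipalUltrafilter U = IsUltrafilter U × (∀ n → ¬ U (singleton n))

IsCofinalIn : Family → Family → Set
IsCofinalIn 𝒞 U = (∀ X → 𝒞 X → U X) × (∀ Y → U Y → ∃[ X ] (𝒞 X × X ⊆ Y))

-- A map 𝒰 → 𝒱: a function defined on members of 𝒰 (with membership
-- evidence) taking values in 𝒱.
MapOn : Family → Set
MapOn U = (X : Subset) → U X → Subset

IsMapInto : {U : Family} → MapOn U → Family → Set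
IsMapInto {U} f V = ∀ X (u : U X) → V (f X u)

IsMonotone : {U : Family} → MapOn U → Set
IsMonotone {U} f = ∀ X Y (uX : U X) (uY : U Y) → Y ⊆ X → f Y uY ⊆ f X uX

-- Cofinal map 𝒰 → 𝒱: maps into 𝒱 and the image of every cofinal subset of
-- 𝒰 is cofinal in 𝒱 (image ⊆ 𝒱 is given by IsMapInto).
IsCofinalMap : (U V : Family) → MapOn U → Set₁
IsCofinalMap U V f =
  IsMapInto {U} f V ×
  (∀ (𝒟 : Family) → IsCofinalIn 𝒟 U →
     ∀ Y → V Y → ∃[ X ] (Σ (𝒟 X) λ dX → Σ (U X) λ uX → f X uX ⊆ Y))

-- Finite 0-1 sequences; bit i of s (false beyond the length)
bit : ∀ {n} → Vec Bool n → ℕ → Bool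
bit [] _ = false
bit (b ∷ s) zero = b
bit (b ∷ s) (suc i) = bit s i

_⊑_ : ∀ {n n'} → Vec Bool n → Vec Bool n' → Set
_⊑_ {n} {n'} s t = n ≤ n' × (∀ i → i < n → bit s i ≡ bit t i)

_⊆ˢ_ : ∀ {n n'} → Vec Bool n → Vec Bool n' → Set
s ⊆ˢ t = ∀ i → bit s i ≡ true → bit t i ≡ true

restrict : Subset → (n : ℕ) → Vec Bool n
restrict X n = tabulate (λ j → X (toℕ j))

StrictlyIncreasing : (ℕ → ℕ) → Set
StrictlyIncreasing k = ∀ m → k m < k (suc m)

-- C = {X ↾ k_m : X ∈ 𝒞, m < ω}, graded by the level m
InC : (𝒞 : Family) (k : ℕ → ℕ) (m : ℕ) → Vec Bool (k m) → Set
InC 𝒞 k m s = ∃[ X ] (Σ (𝒞 X) λ _ → restrict X (k m) ≡ s)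

-- A map on C; level preservation (C ∩ 2^{k_m} → 2^m) is built into the type.
LevelMap : (𝒞 : Family) (k : ℕ → ℕ) → Set
LevelMap 𝒞 k = (m : ℕ) (s : Vec Bool (k m)) → InC 𝒞 k m s → Vec Bool m

record IsBasic (𝒞 : Family) (k : ℕ → ℕ) (fh : LevelMap 𝒞 k) : Set where
  field
    endExt : ∀ m m' (s : Vec Bool (k m)) (s' : Vec Bool (k m'))
             (cs : InC 𝒞 k m s) (cs' : InC 𝒞 k m' s') →
             m < m' → s ⊑ s' → fh m s cs ⊑ fh m' s' cs'
    mono   : ∀ m m' (s : Vec Bool (k m)) (t : Vec Bool (k m'))
             (cs : InC 𝒞 k m s) (ct : InC 𝒞 k m' t) →
             s ⊆ˢ t → fh m s cs ⊆ˢ fh m' t ct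

RepresentedByBasic : (𝒞 : Family) → MapOn 𝒞 → Set
RepresentedByBasic 𝒞 f =
  ∃[ k ] (StrictlyIncreasing k ×
    ∃[ fh ] (IsBasic 𝒞 k fh ×
      (∀ X (cX : 𝒞 X) i →
         (f X cX i ≡ true) ⇔
         (∃[ m ] (bit (fh m (restrict X (k m)) (X , cX , refl)) i ≡ true)))))

All : Family
All _ = ⊤

module Submission where

-- Let f̂ be a basic map on C = {X ↾ k_m : X ∈ 𝒞}.  For an arbitrary finite
-- sequence t call i "covered by t" if some s ∈ C with s ⊆ t has f̂(s)(i) = 1.
-- Define ĝ on all of ⋃_m 2^{k_m} by  ĝ(t)(i) = 1  iff  i is covered by t
-- (excluded middle turns this predicate into a bit).  Monotonicity of f̂
-- bounds the covered indices of t ∈ 2^{k_m} below m, so ĝ is level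
-- preserving; coverage is monotone in t, so ĝ is monotone; and
-- end-extension preservation of f̂ lets a witness at a high level be pushed
-- down to a lower one, so ĝ preserves end-extensions.  Hence ĝ is basic, and
-- the map f̃ it represents is monotone and agrees with f on 𝒞.

open import Defs
open import Level using (0ℓ; Lift; lift; lower)
open import Axiom.ExcludedMiddle using (ExcludedMiddle)
open import Data.Bool using (Bool; true; false)
open import Data.Nat using (ℕ; zero; suc; _<_; _≤_; _≤′_; ≤′-reflexive; ≤′-step; z≤n; s≤s; _≤?_)
open import Data.Nat.Properties using (≤-refl; ≤-trans; <⇒≤; <-≤-trans; ≰⇒>; ≤⇒≤′)
open import Data.Fin using (Fin; toℕ; fromℕ<)
open import Data.Fin.Properties using (toℕ-fromℕ<)
open import Data.Vec using (Vec; _∷_; tabulate)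
open import Data.Product using (Σ; ∃; ∃-syntax; _×_; _,_; proj₂)
open import Data.Unit using (tt)
open import Relation.Nullary using (Dec; does; yes; no)
open import Relation.Nullary.Decidable using (map′; dec-true)
open import Relation.Binary.PropositionalEquality using (_≡_; refl; sym; trans; cong)
open import Function.Bundles using (_⇔_; mk⇔; Equivalence)

bool-ext : ∀ {a b : Bool} → (a ≡ true → b ≡ true) → (b ≡ true → a ≡ true) → a ≡ b
bool-ext {true}  {true}  _ _ = refl
bool-ext {true}  {false} a⇒b _ = sym (a⇒b refl)
bool-ext {false} {true}  _ b⇒a = b⇒a refl
bool-ext {false} {false} _ _ = refl

-- Excluded middle assigns a truth value to every proposition; this is how
-- the non-constructive bits of ĝ and f̃ are defined.
module Classical (em : ExcludedMiddle (Level.suc 0ℓ)) where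

  decide : (P : Set) → Dec P
  decide P = map′ lower lift (em {Lift (Level.suc 0ℓ) P})

  holds : Set → Bool
  holds P = does (decide P)

  holds-intro : {P : Set} → P → holds P ≡ true
  holds-intro {P} = dec-true (decide P)

  holds-elim : {P : Set} → holds P ≡ true → P
  holds-elim {P} = from-does (decide P)
    where
    from-does : (d : Dec P) → does d ≡ true → P
    from-does (yes p) _ = p
    from-does (no _)  ()

bit-len : ∀ {n} (v : Vec Bool n) i → bit v i ≡ true → i < n
bit-len (b ∷ v) zero    _ = s≤s z≤n
bit-len (b ∷ v) (suc i) h = s≤s (bit-len v i h)

bit-tabulate-fin : ∀ {n} (h : Fin n → Bool) i (i<n : i < n) → bit (tabulate h) i ≡ h (fromℕ< i<n)
bit-tabulate-fin {suc n} h zero    _         = refl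
bit-tabulate-fin {suc n} h (suc i) (s≤s i<n) = bit-tabulate-fin (λ j → h (Fin.suc j)) i i<n

bit-tabulate : ∀ {n} (h : ℕ → Bool) i → i < n → bit (tabulate {n = n} (λ j → h (toℕ j))) i ≡ h i
bit-tabulate h i i<n = trans (bit-tabulate-fin _ i i<n) (cong h (toℕ-fromℕ< i<n))

⊆ˢ-refl : ∀ {n} (s : Vec Bool n) → s ⊆ˢ s
⊆ˢ-refl s i h = h

⊆ˢ-trans : ∀ {n n' n''} (s : Vec Bool n) (t : Vec Bool n') (u : Vec Bool n'') →
           s ⊆ˢ t → t ⊆ˢ u → s ⊆ˢ u
⊆ˢ-trans s t u s⊆t t⊆u i h = t⊆u i (s⊆t i h)

⊑⇒⊆ˢ : ∀ {n n'} (s : Vec Bool n) (t : Vec Bool n') → s ⊑ t → s ⊆ˢ t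
⊑⇒⊆ˢ s t (_ , agree) i h = trans (sym (agree i (bit-len s i h))) h

⊆ˢ-cut : ∀ {n n' n''} (s : Vec Bool n) (t : Vec Bool n') (t' : Vec Bool n'') →
         n ≤ n' → t ⊑ t' → s ⊆ˢ t' → s ⊆ˢ t
⊆ˢ-cut s t t' n≤n' (_ , agree) s⊆t' i h =
  trans (agree i (<-≤-trans (bit-len s i h) n≤n')) (s⊆t' i h)

restrict-⊑ : ∀ X {n n'} → n ≤ n' → restrict X n ⊑ restrict X n'
restrict-⊑ X n≤n' = n≤n' , λ i i<n →
  trans (bit-tabulate X i i<n) (sym (bit-tabulate X i (<-≤-trans i<n n≤n')))

restrict-⊆ˢ : ∀ {X Y} n → Y ⊆ X → restrict Y n ⊆ˢ restrict X n
restrict-⊆ˢ {X} {Y} n Y⊆X i h =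
  let i<n = bit-len (restrict Y n) i h in
  trans (bit-tabulate X i i<n) (Y⊆X i (trans (sym (bit-tabulate Y i i<n)) h))

restrict-⊆ˢ-restrict : ∀ X n {n'} (t : Vec Bool n') → restrict X n ⊆ˢ t → restrict X n ⊆ˢ restrict X n'
restrict-⊆ˢ-restrict X n t sub i h =
  trans (bit-tabulate X i (bit-len t i (sub i h)))
        (trans (sym (bit-tabulate X i (bit-len (restrict X n) i h))) h)

increasing-mono : ∀ {k : ℕ → ℕ} → StrictlyIncreasing k → ∀ {m m'} → m ≤ m' → k m ≤ k m'
increasing-mono {k} inc m≤m' = go (≤⇒≤′ m≤m')
  where
  go : ∀ {m m'} → m ≤′ m' → k m ≤ k m'
  go (≤′-reflexive refl) = ≤-refl
  go (≤′-step m≤m')      = ≤-trans (go m≤m') (<⇒≤ (inc _))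

module Extension (em : ExcludedMiddle (Level.suc 0ℓ)) {𝒞 : Family} {k : ℕ → ℕ}
  (inc : StrictlyIncreasing k) {fh : LevelMap 𝒞 k} (basic : IsBasic 𝒞 k fh) where

  open Classical em
  open IsBasic basic

  Covered : ∀ {n} → Vec Bool n → ℕ → Set
  Covered t i = ∃[ m ] Σ (Vec Bool (k m)) λ s → Σ (InC 𝒞 k m s) λ cs →
                  s ⊆ˢ t × bit (fh m s cs) i ≡ true

  covered-mono : ∀ {n n'} (t : Vec Bool n) (t' : Vec Bool n') {i} → t ⊆ˢ t' → Covered t i → Covered t' i
  covered-mono t t' t⊆t' (m , s , cs , s⊆t , b) = m , s , cs , ⊆ˢ-trans s t t' s⊆t t⊆t' , b

  -- On C itself, coverage is exactly f̂: the covering witness can be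
  -- replaced by the sequence itself by monotonicity of f̂.
  covered-sound : ∀ X (cX : 𝒞 X) m i → Covered (restrict X (k m)) i →
                  bit (fh m (restrict X (k m)) (X , cX , refl)) i ≡ true
  covered-sound X cX m i (m'' , s , cs , s⊆X , b) = mono m'' m s _ cs (X , cX , refl) s⊆X i b

  covered-complete : ∀ X (cX : 𝒞 X) m i → bit (fh m (restrict X (k m)) (X , cX , refl)) i ≡ true →
                     Covered (restrict X (k m)) i
  covered-complete X cX m i b = m , restrict X (k m) , (X , cX , refl) , ⊆ˢ-refl (restrict X (k m)) , b

  -- Indices covered by t ∈ 2^{k_m} lie below m, so ĝ is level preserving.
  covered-bound : ∀ m (t : Vec Bool (k m)) i → Covered t i → i < m
  covered-bound m t i (m'' , _ , (X , cX , refl) , X⊆t , b) =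
    bit-len (fh m (restrict X (k m)) (X , cX , refl)) i
      (covered-sound X cX m i (m'' , _ , (X , cX , refl) , restrict-⊆ˢ-restrict X (k m'') t X⊆t , b))

  -- Coverage of an index below m passes from an extension t' back to t;
  -- a witness at a level above m is pushed down to level m using
  -- end-extension preservation of f̂.
  covered-below : ∀ m m' (t : Vec Bool (k m)) (t' : Vec Bool (k m')) i →
                  t ⊑ t' → i < m → Covered t' i → Covered t i
  covered-below m m' t t' i t⊑t' i<m (m'' , s , (X , cX , refl) , s⊆t' , b) with m'' ≤? m
  ... | yes m''≤m = m'' , s , (X , cX , refl) , ⊆ˢ-cut s t t' (increasing-mono inc m''≤m) t⊑t' s⊆t' , b
  ... | no  m''≰m =
    m , Xm , (X , cX , refl) ,
    ⊆ˢ-cut Xm t t' ≤-refl t⊑t' (⊆ˢ-trans Xm Xm'' t' (⊑⇒⊆ˢ Xm Xm'' Xm⊑Xm'') s⊆t') ,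
    trans (proj₂ (endExt m m'' _ _ (X , cX , refl) (X , cX , refl) m<m'' Xm⊑Xm'') i i<m) b
    where
    m<m'' : m < m''
    m<m'' = ≰⇒> m''≰m
    Xm : Vec Bool (k m)
    Xm'' : Vec Bool (k m'')
    Xm = restrict X (k m)
    Xm'' = restrict X (k m'')
    Xm⊑Xm'' : Xm ⊑ Xm''
    Xm⊑Xm'' = restrict-⊑ X (increasing-mono inc (<⇒≤ m<m''))

  g : LevelMap All k
  g m t _ = tabulate (λ j → holds (Covered t (toℕ j)))

  -- Reading the bits of ĝ; introduction uses that covered indices are in range.
  g-elim : ∀ m t c i → bit (g m t c) i ≡ true → Covered t i
  g-elim m t c i h = holds-elim (trans (sym (bit-tabulate _ i (bit-len (g m t c) i h))) h)

  g-intro : ∀ m t c i → Covered t i → bit (g m t c) i ≡ true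
  g-intro m t c i cov = trans (bit-tabulate _ i (covered-bound m t i cov)) (holds-intro cov)

  g-basic : IsBasic All k g
  g-basic = record { endExt = g-endExt ; mono = g-mono }
    where
    g-mono : ∀ m m' (s : Vec Bool (k m)) (t : Vec Bool (k m')) (cs : InC All k m s) (ct : InC All k m' t) →
             s ⊆ˢ t → g m s cs ⊆ˢ g m' t ct
    g-mono m m' s t cs ct s⊆t i h = g-intro m' t ct i (covered-mono s t s⊆t (g-elim m s cs i h))

    g-endExt : ∀ m m' (t : Vec Bool (k m)) (t' : Vec Bool (k m')) (ct : InC All k m t) (ct' : InC All k m' t') →
               m < m' → t ⊑ t' → g m t ct ⊑ g m' t' ct'
    g-endExt m m' t t' ct ct' m<m' t⊑t' = <⇒≤ m<m' , λ i i<m → bool-ext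
      (λ h → g-intro m' t' ct' i (covered-mono t t' (⊑⇒⊆ˢ t t' t⊑t') (g-elim m t ct i h)))
      (λ h → g-intro m t ct i (covered-below m m' t t' i t⊑t' i<m (g-elim m' t' ct' i h)))

  InUnion : Subset → ℕ → Set
  InUnion X i = ∃[ m ] bit (g m (restrict X (k m)) (X , tt , refl)) i ≡ true

  ft : Subset → Subset
  ft X i = holds (InUnion X i)

  ft-represented : RepresentedByBasic All (λ X _ → ft X)
  ft-represented = k , inc , g , g-basic , λ X _ i → mk⇔ holds-elim holds-intro

  ft-monotone : IsMonotone {All} (λ X _ → ft X)
  ft-monotone X Y _ _ Y⊆X i h with holds-elim h
  ... | m , b = holds-intro (m , g-intro m Xm (X , tt , refl) i
                  (covered-mono Ym Xm (restrict-⊆ˢ (k m) Y⊆X) (g-elim m Ym (Y , tt , refl) i b)))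
    where
    Xm Ym : Vec Bool (k m)
    Xm = restrict X (k m)
    Ym = restrict Y (k m)

  ft-on-C : ∀ X (cX : 𝒞 X) i →
            (ft X i ≡ true) ⇔ (∃[ m ] bit (fh m (restrict X (k m)) (X , cX , refl)) i ≡ true)
  ft-on-C X cX i = mk⇔
    (λ h → from-union (holds-elim h))
    (λ { (m , b) → holds-intro (m , g-intro m (restrict X (k m)) (X , tt , refl) i (covered-complete X cX m i b)) })
    where
    from-union : InUnion X i → ∃[ m ] bit (fh m (restrict X (k m)) (X , cX , refl)) i ≡ true
    from-union (m , b) = m , covered-sound X cX m i (g-elim m (restrict X (k m)) (X , tt , refl) i b)

-- A monotone map f̃ on 2^ω agreeing with a cofinal map f : 𝒰 → 𝒱 on a
-- cofinal family 𝒞 ⊆ 𝒰 is itself cofinal from 𝒰 to 𝒱: below any X ∈ 𝒰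
-- there is Z ∈ 𝒞 with f̃(Z) = f(Z) ∈ 𝒱, and below any X ∈ 𝒞 with f(X) ⊆ Y
-- every member D ⊆ X of a cofinal family has f̃(D) ⊆ f̃(X) = f(X).
agreeing-extension-cofinal :
  (U V : Family) → (∀ {X Y} → V X → X ⊆ Y → V Y) →
  (f : MapOn U) → IsMapInto {U} f V → IsMonotone {U} f → IsCofinalMap U V f →
  (𝒞 : Family) (c⇒u : ∀ X → 𝒞 X → U X) → IsCofinalIn 𝒞 U →
  (ft : Subset → Subset) → IsMonotone {All} (λ X _ → ft X) →
  (∀ X (cX : 𝒞 X) i → ft X i ≡ f X (c⇒u X cX) i) →
  IsCofinalMap U V (λ X _ → ft X)
agreeing-extension-cofinal U V upV f fInto fMono (_ , fCof) 𝒞 c⇒u (_ , 𝒞-below) ft ftMono agree =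
  into , cofinal
  where
  into : IsMapInto {U} (λ X _ → ft X) V
  into X uX with 𝒞-below X uX
  ... | Z , cZ , Z⊆X =
    upV (fInto Z (c⇒u Z cZ)) (λ i h → ftMono X Z tt tt Z⊆X i (trans (agree Z cZ i) h))

  cofinal : ∀ (𝒟 : Family) → IsCofinalIn 𝒟 U →
            ∀ Y → V Y → ∃[ X ] (Σ (𝒟 X) λ dX → Σ (U X) λ uX → ft X ⊆ Y)
  cofinal 𝒟 (𝒟⊆U , 𝒟-below) Y vY with fCof 𝒞 (c⇒u , 𝒞-below) Y vY
  ... | X , cX , uX , fX⊆Y with 𝒟-below X (c⇒u X cX)
  ... | D , dD , D⊆X = D , dD , 𝒟⊆U D dD , λ i h →
    fX⊆Y i (fMono X X uX (c⇒u X cX) (λ _ e → e) i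
             (trans (sym (agree X cX i)) (ftMono X D tt tt D⊆X i h)))

lemma2p4 : ExcludedMiddle (Level.suc 0ℓ) →
    (U V : Family) → IsNonprincipalUltrafilter U → IsNonprincipalUltrafilter V →
    (f : MapOn U) → IsMapInto {U} f V → IsMonotone {U} f → IsCofinalMap U V f →
    (𝒞 : Family) (c⇒u : ∀ X → 𝒞 X → U X) → IsCofinalIn 𝒞 U →
    RepresentedByBasic 𝒞 (λ X cX → f X (c⇒u X cX)) →
    Σ (Subset → Subset) λ ft →
    IsMonotone {All} (λ X _ → ft X) ×
    RepresentedByBasic All (λ X _ → ft X) ×
    (∀ X (cX : 𝒞 X) i → ft X i ≡ f X (c⇒u X cX) i) ×
    IsCofinalMap U V (λ X _ → ft X)
lemma2p4 em U V _ (uV , _) f fInto fMono fCof 𝒞 c⇒u cof𝒞 (k , inc , fh , basic , rep) =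
  ft , ft-monotone , ft-represented , agree ,
  agreeing-extension-cofinal U V (IsUltrafilter.upward uV) f fInto fMono fCof
    𝒞 c⇒u cof𝒞 ft ft-monotone agree
  where
  open Extension em inc basic

  -- Both f̃(X) and f(X) are ⋃_m f̂(X ↾ k_m) for X ∈ 𝒞.
  agree : ∀ X (cX : 𝒞 X) i → ft X i ≡ f X (c⇒u X cX) i
  agree X cX i = bool-ext
    (λ h → Equivalence.from (rep X cX i) (Equivalence.to (ft-on-C X cX i) h))
    (λ h → Equivalence.from (ft-on-C X cX i) (Equivalence.to (rep X cX i) h))
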